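{- Let $w\in F_{\mathrm{odd}}$ have even rank. Then the rooted tree $F_{\mathrm{odd}}^w$ has the following structure: its root $w$ has exactly one child, $1w$; the node $1w$ has exactly two children, $11w$ and $2w$; the subtree of $F_{\mathrm{odd}}^w$ rooted at $11w$ is $F_{\mathrm{odd}}\,11w$, and the subtree rooted at $2w$ is $F_{\mathrm{odd}}\,2w$. Here, for a word $x$, $F_{\mathrm{odd}}\,x$ denotes the tree with vertex set $\{ux : u\in F_{\mathrm{odd}}\}$ in which $ux$ and $u'x$ are adjacent iff $u$ and $u'$ are adjacent in $F_{\mathrm{odd}}$ (a copy of $F_{\mathrm{odd}}$ with each label $u$ replaced by the concatenation $ux$).
   Context: For $n\ge 0$, let $F(n)$ be the set of all words $w=x_1\dotsb x_l$ with each $x_i\in\{1,2\}$ and $\sum_i x_i=n$; the rank of such $w$ is $n$, and $F=\coprod_{n\ge0}F(n)$ ($F(0)$ contains only the empty word $\emptyset$). The Young–Fibonacci graph has vertex set $F$, with an edge between $v\in F(n)$ and $w\in F(n+1)$ (written $v\in w^-$, $w\in v^+$; $w$ covers $v$) iff either (1) $v$ is obtained from $w$ by changing into a $1$ some $2$ of $w$ that has no $1$ to its left, or (2) $v$ is obtained from $w$ by removing its leftmost $1$. The $f$-statistic is defined by $f_\emptyset=1$ and $f_w=\sum_{v\in w^- }f_v$. A word $w$ is odd if $f_w$ is odd; $F_{\mathrm{odd}}$ is the subgraph of the Young–Fibonacci graph induced by the odd words; it is a tree rooted at $\emptyset$. For $w\in F_{\mathrm{odd}}$, $F_{\mathrm{odd}}^w$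 denotes the induced subtree rooted at $w$ consisting of those odd words $v$ that are connected to $w$ by a saturated chain $w=v_0,v_1,\dots,v_s=v$ (each $v_{j+1}$ covering $v_j$) with all $v_j\in F_{\mathrm{odd}}$. -}

module Defs where

open import Data.Nat using (ℕ; zero; suc; _+_; _%_)
open import Data.List using (List; []; _∷_; _++_; map; replicate)
open import Data.Nat.ListAction using (sum)
open import Data.Product using (_×_; Σ; ∃)
open import Data.Sum using (_⊎_)
open import Relation.Binary.PropositionalEquality using (_≡_)

data Letter : Set where
  one two : Letter

Word : Set
Word = List Letter

val : Letter → ℕ
val one = 1
val two = 2

rank : Word → ℕ
rank [] = 0
rank (x ∷ w) = val x + rank w

-- Covers w v  :  w covers v in the Young–Fibonacci graph (v ∈ w⁻).
-- (1) v is w with some 2 having no 1 to its left (so only 2's to its left) changed into 1;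
-- (2) v is w with its leftmost 1 removed (only 2's to its left).
data Covers : Word → Word → Set where
  change : ∀ k u → Covers (replicate k two ++ two ∷ u) (replicate k two ++ one ∷ u)
  remove : ∀ k u → Covers (replicate k two ++ one ∷ u) (replicate k two ++ u)

down : Word → List Word
down [] = []
down (one ∷ u) = u ∷ []
down (two ∷ u) = (one ∷ u) ∷ map (two ∷_) (down u)

-- f-statistic: f ∅ = 1, f w = Σ_{v ∈ w⁻} f v  (recursion on the rank, all v ∈ w⁻ have rank n-1)
fAux : ℕ → Word → ℕ
fAux zero _ = 1
fAux (suc n) w = sum (map (fAux n) (down w))

f : Word → ℕ
f w = fAux (rank w) w

Odd : Word → Set
Odd w = f w % 2 ≡ 1

-- Reach r v : v is a vertex of the subtree F_odd^r, i.e. there is a saturated chain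
-- r = v₀ ⋖ v₁ ⋖ … ⋖ vₛ = v with every vⱼ odd.
data Reach (r : Word) : Word → Set where
  here : Odd r → Reach r r
  step : ∀ {v v'} → Reach r v → Covers v' v → Odd v' → Reach r v'

-- The subtree of F_odd^w rooted at x (x itself a vertex of F_odd^w) is (as a rooted tree)
-- the copy F_odd·x: u ↦ u ++ x maps the odd words exactly onto the vertices of F_odd^x,
-- and preserves and reflects the cover (parent–child) relation.
IsCopy : Word → Set
IsCopy x =
  (∀ u → Odd u → Reach x (u ++ x))
  × (∀ v → Reach x v → Σ Word (λ u → Odd u × v ≡ u ++ x))
  × (∀ u u' → Odd u → Odd u' →
       (Covers (u' ++ x) (u ++ x) → Covers u' u) × (Covers u' u → Covers (u' ++ x) (u ++ x)))

module Submission where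

-- Recursively f(1u) = f(u) and f(2u) = (rank u + 1) f(u), so a word is odd exactly when
-- every letter 2 in it is followed by a suffix of even rank.  For a word x of even rank this
-- condition holds for u ++ x iff it holds for u and x, and the only odd upper cover of x is 1x.
-- Consequently every odd upper cover of u ++ x is u' ++ x with u' an upper cover of u, so for
-- an odd x of even rank the odd subtree rooted at x is the translate F_odd x.  Below an odd w
-- of even rank the only odd cover is 1w, whose covers 11w and 2w are odd of even rank.

open import Defs
open import Data.Nat.Base using (zero; suc; _+_; _*_; _%_; parity)
open import Data.Nat.Properties using (+-identityʳ; *-zeroʳ; *-distribˡ-+; suc-injective)
open import Data.Nat.ListAction using (sum)
open import Data.Parity.Base as ℙ using (0ℙ; 1ℙ; _⁻¹)
open import Data.Parity.Properties using (+-homo-+; *-homo-*; ⁻¹-selfInverse)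
open import Data.List.Base using ([]; _∷_; _++_; map)
open import Data.List.Properties using (map-∘; map-cong-local; ++-cancelʳ)
open import Data.List.Relation.Unary.All as All using (All; []; _∷_)
open import Data.List.Relation.Unary.All.Properties using (map⁺)
open import Data.Product.Base using (_×_; Σ; _,_)
open import Data.Sum.Base using (_⊎_; inj₁; inj₂)
open import Data.Empty using (⊥)
open import Function.Base using (_∘_)
open import Relation.Binary.PropositionalEquality
  using (_≡_; refl; sym; trans; cong; cong₂; subst; module ≡-Reasoning)

private
  variable
    u v w x : Word

%2≡1⇒parity≡1ℙ : ∀ n → n % 2 ≡ 1 → parity n ≡ 1ℙ
%2≡1⇒parity≡1ℙ 1 _ = refl
%2≡1⇒parity≡1ℙ (suc (suc n)) = %2≡1⇒parity≡1ℙ n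

parity≡1ℙ⇒%2≡1 : ∀ n → parity n ≡ 1ℙ → n % 2 ≡ 1
parity≡1ℙ⇒%2≡1 1 _ = refl
parity≡1ℙ⇒%2≡1 (suc (suc n)) = parity≡1ℙ⇒%2≡1 n

%2≡0⇒parity≡0ℙ : ∀ n → n % 2 ≡ 0 → parity n ≡ 0ℙ
%2≡0⇒parity≡0ℙ 0 _ = refl
%2≡0⇒parity≡0ℙ (suc (suc n)) = %2≡0⇒parity≡0ℙ n

parity-suc : ∀ n → parity (suc n) ≡ parity n ⁻¹
parity-suc = +-homo-+ 1

parity≡0ℙ⇒parity-suc≢0ℙ : ∀ n → parity n ≡ 0ℙ → parity (suc n) ≡ 0ℙ → ⊥
parity≡0ℙ⇒parity-suc≢0ℙ n e e′ with trans (sym e′) (trans (parity-suc n) (cong _⁻¹ e))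
... | ()

*≡1ℙ⇒ : ∀ p q → p ℙ.* q ≡ 1ℙ → p ≡ 1ℙ × q ≡ 1ℙ
*≡1ℙ⇒ 1ℙ 1ℙ _ = refl , refl

sum-map-*ˡ : ∀ c ns → sum (map (c *_) ns) ≡ c * sum ns
sum-map-*ˡ c [] = sym (*-zeroʳ c)
sum-map-*ˡ c (n ∷ ns) = trans (cong (c * n +_) (sum-map-*ˡ c ns)) (sym (*-distribˡ-+ c n (sum ns)))

rank-down : ∀ w → All (λ v → rank w ≡ suc (rank v)) (down w)
rank-down [] = []
rank-down (one ∷ u) = refl ∷ []
rank-down (two ∷ u) = refl ∷ map⁺ (All.map (cong (2 +_)) (rank-down u))

fAux-two∷ : ∀ n u → rank u ≡ n → fAux (2 + n) (two ∷ u) ≡ suc n * fAux n u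
fAux-two∷ zero [] _ = refl
fAux-two∷ zero (one ∷ _) ()
fAux-two∷ zero (two ∷ _) ()
fAux-two∷ (suc m) u ru = cong₂ _+_ (+-identityʳ (fAux (suc m) u)) covers-through-two
  where
  open ≡-Reasoning
  covers-through-two : sum (map (fAux (2 + m)) (map (two ∷_) (down u))) ≡ suc m * fAux (suc m) u
  covers-through-two = begin
    sum (map (fAux (2 + m)) (map (two ∷_) (down u)))  ≡⟨ cong sum (map-∘ (down u)) ⟨
    sum (map (fAux (2 + m) ∘ (two ∷_)) (down u))      ≡⟨ cong sum (map-cong-local (All.map
                                                           (λ {v} p → fAux-two∷ m v (suc-injective (trans (sym p) ru)))
                                                           (rank-down u))) ⟩
    sum (map ((suc m *_) ∘ fAux m) (down u))          ≡⟨ cong sum (map-∘ (down u)) ⟩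
    sum (map (suc m *_) (map (fAux m) (down u)))      ≡⟨ sum-map-*ˡ (suc m) (map (fAux m) (down u)) ⟩
    suc m * fAux (suc m) u                            ∎

f-one∷ : ∀ u → f (one ∷ u) ≡ f u
f-one∷ u = +-identityʳ (f u)

f-two∷ : ∀ u → f (two ∷ u) ≡ suc (rank u) * f u
f-two∷ u = fAux-two∷ (rank u) u refl

parity-f-two∷ : ∀ u → parity (f (two ∷ u)) ≡ parity (rank u) ⁻¹ ℙ.* parity (f u)
parity-f-two∷ u = begin
  parity (f (two ∷ u))                      ≡⟨ cong parity (f-two∷ u) ⟩
  parity (suc (rank u) * f u)               ≡⟨ *-homo-* (suc (rank u)) (f u) ⟩
  parity (suc (rank u)) ℙ.* parity (f u)    ≡⟨ cong (ℙ._* parity (f u)) (parity-suc (rank u)) ⟩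
  parity (rank u) ⁻¹ ℙ.* parity (f u)       ∎
  where open ≡-Reasoning

data Admissible : Word → Set where
  []   : Admissible []
  one∷ : Admissible u → Admissible (one ∷ u)
  two∷ : parity (rank u) ≡ 0ℙ → Admissible u → Admissible (two ∷ u)

admissible⇒parity-f≡1ℙ : Admissible w → parity (f w) ≡ 1ℙ
admissible⇒parity-f≡1ℙ [] = refl
admissible⇒parity-f≡1ℙ (one∷ {u} a) = trans (cong parity (f-one∷ u)) (admissible⇒parity-f≡1ℙ a)
admissible⇒parity-f≡1ℙ (two∷ {u} e a) =
  trans (parity-f-two∷ u) (cong₂ (λ p q → p ⁻¹ ℙ.* q) e (admissible⇒parity-f≡1ℙ a))

parity-f≡1ℙ⇒admissible : ∀ w → parity (f w) ≡ 1ℙ → Admissible w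
parity-f≡1ℙ⇒admissible [] _ = []
parity-f≡1ℙ⇒admissible (one ∷ u) o =
  one∷ (parity-f≡1ℙ⇒admissible u (trans (sym (cong parity (f-one∷ u))) o))
parity-f≡1ℙ⇒admissible (two ∷ u) o with *≡1ℙ⇒ _ _ (trans (sym (parity-f-two∷ u)) o)
... | even-suffix , odd-u = two∷ (sym (⁻¹-selfInverse even-suffix)) (parity-f≡1ℙ⇒admissible u odd-u)

admissible⇒odd : Admissible w → Odd w
admissible⇒odd {w} a = parity≡1ℙ⇒%2≡1 (f w) (admissible⇒parity-f≡1ℙ a)

odd⇒admissible : ∀ w → Odd w → Admissible w
odd⇒admissible w o = parity-f≡1ℙ⇒admissible w (%2≡1⇒parity≡1ℙ (f w) o)

rank-++ : ∀ u x → rank (u ++ x) ≡ rank u + rank x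
rank-++ [] x = refl
rank-++ (one ∷ u) x = cong (1 +_) (rank-++ u x)
rank-++ (two ∷ u) x = cong (2 +_) (rank-++ u x)

parity-rank-++-even : parity (rank x) ≡ 0ℙ → ∀ u → parity (rank (u ++ x)) ≡ parity (rank u)
parity-rank-++-even {x} ex u = begin
  parity (rank (u ++ x))               ≡⟨ cong parity (rank-++ u x) ⟩
  parity (rank u + rank x)             ≡⟨ +-homo-+ (rank u) (rank x) ⟩
  parity (rank u) ℙ.+ parity (rank x)  ≡⟨ cong (parity (rank u) ℙ.+_) ex ⟩
  parity (rank u) ℙ.+ 0ℙ               ≡⟨ +-homo-+ (rank u) 0 ⟨
  parity (rank u + 0)                  ≡⟨ cong parity (+-identityʳ (rank u)) ⟩
  parity (rank u)                      ∎
  where open ≡-Reasoning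

admissible-++ : parity (rank x) ≡ 0ℙ → Admissible u → Admissible x → Admissible (u ++ x)
admissible-++ ex [] ax = ax
admissible-++ ex (one∷ au) ax = one∷ (admissible-++ ex au ax)
admissible-++ ex (two∷ {u} e au) ax = two∷ (trans (parity-rank-++-even ex u) e) (admissible-++ ex au ax)

admissible-++⁻ : parity (rank x) ≡ 0ℙ → ∀ u → Admissible (u ++ x) → Admissible u
admissible-++⁻ ex [] _ = []
admissible-++⁻ ex (one ∷ u) (one∷ a) = one∷ (admissible-++⁻ ex u a)
admissible-++⁻ ex (two ∷ u) (two∷ e a) =
  two∷ (trans (sym (parity-rank-++-even ex u)) e) (admissible-++⁻ ex u a)

infix 4 _⋗_

data _⋗_ : Word → Word → Set where
  remove₁ : one ∷ u ⋗ u
  change₂ : two ∷ u ⋗ one ∷ u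
  under₂  : v ⋗ u → two ∷ v ⋗ two ∷ u

Covers-two∷ : Covers v u → Covers (two ∷ v) (two ∷ u)
Covers-two∷ (change k u) = change (suc k) u
Covers-two∷ (remove k u) = remove (suc k) u

Covers⇒⋗ : Covers v u → v ⋗ u
Covers⇒⋗ (change zero u) = change₂
Covers⇒⋗ (change (suc k) u) = under₂ (Covers⇒⋗ (change k u))
Covers⇒⋗ (remove zero u) = remove₁
Covers⇒⋗ (remove (suc k) u) = under₂ (Covers⇒⋗ (remove k u))

⋗⇒Covers : v ⋗ u → Covers v u
⋗⇒Covers remove₁ = remove 0 _
⋗⇒Covers change₂ = change 0 _
⋗⇒Covers (under₂ c) = Covers-two∷ (⋗⇒Covers c)

⋗-++ʳ : ∀ x → v ⋗ u → v ++ x ⋗ u ++ x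
⋗-++ʳ x remove₁ = remove₁
⋗-++ʳ x change₂ = change₂
⋗-++ʳ x (under₂ c) = under₂ (⋗-++ʳ x c)

admissibleCover-of-even : parity (rank w) ≡ 0ℙ → v ⋗ w → Admissible v → v ≡ one ∷ w
admissibleCover-of-even _ remove₁ _ = refl
admissibleCover-of-even ew change₂ (two∷ {u} e _) with () ← parity≡0ℙ⇒parity-suc≢0ℙ (rank u) e ew
admissibleCover-of-even {two ∷ w} ew (under₂ c) (two∷ e a) with refl ← admissibleCover-of-even ew c a
  with () ← parity≡0ℙ⇒parity-suc≢0ℙ (rank w) ew e

covers-one∷ : v ⋗ one ∷ w → v ≡ one ∷ one ∷ w ⊎ v ≡ two ∷ w
covers-one∷ remove₁ = inj₁ refl
covers-one∷ change₂ = inj₂ refl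

admissibleCover-of-++ : parity (rank x) ≡ 0ℙ → ∀ u → v ⋗ u ++ x → Admissible v →
                        Σ Word (λ u′ → v ≡ u′ ++ x × u′ ⋗ u)
admissibleCover-of-++ ex [] c a = one ∷ [] , admissibleCover-of-even ex c a , remove₁
admissibleCover-of-++ ex (one ∷ u) remove₁ _ = one ∷ one ∷ u , refl , remove₁
admissibleCover-of-++ ex (one ∷ u) change₂ _ = two ∷ u , refl , change₂
admissibleCover-of-++ ex (two ∷ u) remove₁ _ = one ∷ two ∷ u , refl , remove₁
admissibleCover-of-++ ex (two ∷ u) (under₂ c) (two∷ _ a) with admissibleCover-of-++ ex u c a
... | u′ , refl , c′ = two ∷ u′ , refl , under₂ c′

module _ {x} (ax : Admissible x) (ex : parity (rank x) ≡ 0ℙ) where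

  private
    odd-++ : Admissible u → Odd (u ++ x)
    odd-++ au = admissible⇒odd (admissible-++ ex au ax)

  reach-++ : Admissible u → Reach x (u ++ x)
  reach-++ [] = here (admissible⇒odd ax)
  reach-++ (one∷ {u} a) = step (reach-++ a) (remove 0 (u ++ x)) (odd-++ (one∷ a))
  reach-++ (two∷ {u} e a) =
    step (step (reach-++ a) (remove 0 (u ++ x)) (odd-++ (one∷ a))) (change 0 (u ++ x)) (odd-++ (two∷ e a))

  reach⇒++ : ∀ v → Reach x v → Σ Word (λ u → Odd u × v ≡ u ++ x)
  reach⇒++ _ (here _) = [] , refl , refl
  reach⇒++ _ (step r c o) with reach⇒++ _ r
  ... | u , _ , refl with admissibleCover-of-++ ex u (Covers⇒⋗ c) (odd⇒admissible _ o)
  ... | u′ , refl , _ = u′ , admissible⇒odd (admissible-++⁻ ex u′ (odd⇒admissible _ o)) , refl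

  Covers-++ʳ⁻ : ∀ u u′ → Odd u′ → Covers (u′ ++ x) (u ++ x) → Covers u′ u
  Covers-++ʳ⁻ u u′ ou′ c with admissibleCover-of-++ ex u (Covers⇒⋗ c) (odd⇒admissible _ (odd-++ (odd⇒admissible u′ ou′)))
  ... | u″ , e , c″ = subst (λ t → Covers t u) (sym (++-cancelʳ x u′ u″ e)) (⋗⇒Covers c″)

  isCopy : IsCopy x
  isCopy = (λ u ou → reach-++ (odd⇒admissible u ou))
         , reach⇒++
         , λ u u′ _ ou′ → Covers-++ʳ⁻ u u′ ou′ , ⋗⇒Covers ∘ ⋗-++ʳ x ∘ Covers⇒⋗

mainTheorem5 : ∀ (w : Word) → Odd w → rank w % 2 ≡ 0 →
    (∀ x → ((Covers x w × Odd x) → x ≡ one ∷ w) × (x ≡ one ∷ w → Covers x w × Odd x))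
    × (∀ x → ((Covers x (one ∷ w) × Odd x) → (x ≡ one ∷ one ∷ w ⊎ x ≡ two ∷ w))
           × ((x ≡ one ∷ one ∷ w ⊎ x ≡ two ∷ w) → Covers x (one ∷ w) × Odd x))
    × IsCopy (one ∷ one ∷ w)
    × IsCopy (two ∷ w)
mainTheorem5 w ow er =
    (λ x → (λ (c , o) → admissibleCover-of-even ew (Covers⇒⋗ c) (odd⇒admissible x o))
         , λ { refl → remove 0 w , admissible⇒odd (one∷ aw) })
  , (λ x → (λ (c , _) → covers-one∷ (Covers⇒⋗ c))
         , λ { (inj₁ refl) → remove 0 (one ∷ w) , admissible⇒odd a11w
             ; (inj₂ refl) → change 0 w , admissible⇒odd a2w })
  , isCopy a11w ew
  , isCopy a2w ew
  where
  ew : parity (rank w) ≡ 0ℙ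
  ew = %2≡0⇒parity≡0ℙ (rank w) er
  aw : Admissible w
  aw = odd⇒admissible w ow
  a11w : Admissible (one ∷ one ∷ w)
  a11w = one∷ (one∷ aw)
  a2w : Admissible (two ∷ w)
  a2w = two∷ ew aw
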